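{- Let $a,b$ be positive integers with $a\ge 2$, and let $\ell$ be a prime with $\ell>\max(a,b)$. Write the base-$a$ expansion of $\ell$ as \[ \ell = a_d a^{d-1} + a_{d-1}a^{d-2}+\cdots+a_2 a + a_1,\qquad 0\le a_i\le a-1 \text{ for all } i,\ a_d\neq 0, \] and define \[ \mathcal{P}(x) := \frac{x\,b}{\ell\,a}\left(a_d x^{d-1}+a_{d-1}x^{d-2}+\cdots+a_1\right). \] Then $\mathcal{P}(a)=b$, i.e. the point $(a,b)$ lies on the curve $y=\mathcal{P}(x)$, and there is no lattice point on this curve strictly between $(0,0)$ and $(a,b)$; that is, for every integer $t$ with $0<t<a$, the number $\mathcal{P}(t)$ is not an integer.
   Context: A lattice point is a point of $\mathbb{Z}^2$. The digits $a_d,\dots,a_1$ are the digits of $\ell$ written in base $a$. -}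

module Defs where

open import Data.Nat using (ℕ; zero; suc; _+_; _*_; NonZero)
open import Data.Nat.Properties using (m*n≢0)
open import Data.List using (List; []; _∷_)
open import Data.Integer using (+_)
open import Data.Rational using (ℚ; _/_)

-- Digit lists are least-significant first: (a₁ ∷ a₂ ∷ … ∷ a_d ∷ []).
-- evalDigits x (a₁ ∷ … ∷ a_d ∷ []) = a_d x^(d-1) + … + a₂ x + a₁
evalDigits : ℕ → List ℕ → ℕ
evalDigits x []       = 0
evalDigits x (c ∷ cs) = c + x * evalDigits x cs

𝒫 : (a b ℓ : ℕ) → .{{NonZero a}} → .{{NonZero ℓ}} → List ℕ → ℕ → ℚ
𝒫 a b ℓ ds x = (+ (x * b * evalDigits x ds)) / (ℓ * a)
  where instance _ = m*n≢0 ℓ a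

-- Since evalDigits a ds = ℓ, the numerator of 𝒫(a) is a b ℓ, so 𝒫(a) = b.
-- For 0 < t < a, the digit polynomial is strictly increasing and has a
-- nonzero leading coefficient, so 0 < evalDigits t ds < ℓ. If 𝒫(t) were an
-- integer, the prime ℓ would divide t · b · evalDigits t ds, hence one of the
-- three factors; but each of them lies strictly between 0 and ℓ.
module Submission where

open import Defs
open import Data.Nat using (ℕ; _≤_; _<_; _⊔_; NonZero)
open import Data.Nat.Primality using (Prime)
open import Data.List using (List; last)
open import Data.List.Relation.Unary.All using (All)
open import Data.Maybe using (just)
open import Data.Integer using (ℤ; +_)
open import Data.Rational using (_/_)
open import Data.Product using (Σ; ∃; _×_)
open import Relation.Binary.PropositionalEquality using (_≡_; _≢_)
open import Relation.Nullary using (¬_)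

open import Data.Nat using (suc; z≤n; _+_; _*_; >-nonZero)
open import Data.Nat.Properties
open import Data.Nat.Divisibility using (_∣_; _∤_; divides; ∣-trans; m∣m*n; >⇒∤)
open import Data.Nat.Primality using (euclidsLemma)
open import Data.List using ([]; _∷_)
open import Data.List.Relation.Unary.All using (_∷_)
open import Data.Integer as ℤ using (∣_∣)
import Data.Integer.Properties as ℤ
open import Data.Rational.Properties using (/-cong; fromℚᵘ-cong; fromℚᵘ-injective)
open import Data.Rational.Unnormalised using (mkℚᵘ; *≡*)
open import Data.Product using (_,_)
open import Data.Sum using (inj₁; inj₂)
open import Relation.Binary.PropositionalEquality using (refl; sym; trans; cong; subst; module ≡-Reasoning)
open import Relation.Nullary using (contradiction)

+[n*d]/d≡+n/1 : ∀ n d .{{_ : NonZero d}} → (+ (n * d)) / d ≡ (+ n) / 1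
+[n*d]/d≡+n/1 n (suc k) = fromℚᵘ-cong {mkℚᵘ (+ (n * suc k)) k} {mkℚᵘ (+ n) 0}
  (*≡* (trans (ℤ.*-identityʳ _) (ℤ.pos-* n (suc k))))

+m/d≡z/1⇒d∣m : ∀ m d .{{_ : NonZero d}} (z : ℤ) → (+ m) / d ≡ z / 1 → d ∣ m
+m/d≡z/1⇒d∣m m (suc k) z eq with fromℚᵘ-injective {mkℚᵘ (+ m) k} {mkℚᵘ z 0} eq
... | *≡* m*1≡z*d = divides ∣ z ∣ (begin
  m                    ≡⟨ *-identityʳ m ⟨
  m * 1                ≡⟨ ℤ.abs-* (+ m) (+ 1) ⟨
  ∣ + m ℤ.* + 1 ∣      ≡⟨ cong ∣_∣ m*1≡z*d ⟩
  ∣ z ℤ.* + suc k ∣    ≡⟨ ℤ.abs-* z (+ suc k) ⟩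
  ∣ z ∣ * suc k        ∎)
  where open ≡-Reasoning

prime∤-* : ∀ {p m n} → Prime p → p ∤ m → p ∤ n → p ∤ m * n
prime∤-* pr p∤m p∤n p∣mn with euclidsLemma _ _ pr p∣mn
... | inj₁ p∣m = p∤m p∣m
... | inj₂ p∣n = p∤n p∣n

LeadingNonZero : List ℕ → Set
LeadingNonZero cs = ∃ λ d → last cs ≡ just d × d ≢ 0

evalDigits-monoˡ-≤ : ∀ {x y} → x ≤ y → ∀ cs → evalDigits x cs ≤ evalDigits y cs
evalDigits-monoˡ-≤ x≤y []       = z≤n
evalDigits-monoˡ-≤ x≤y (c ∷ cs) = +-monoʳ-≤ c (*-mono-≤ x≤y (evalDigits-monoˡ-≤ x≤y cs))

evalDigits-pos : ∀ {x} → 0 < x → ∀ cs → LeadingNonZero cs → 0 < evalDigits x cs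
evalDigits-pos 0<x []       (_ , () , _)
evalDigits-pos 0<x (c ∷ []) (d , refl , d≢0) = ≤-trans (n≢0⇒n>0 d≢0) (m≤m+n d _)
evalDigits-pos {x} 0<x (c ∷ cs@(_ ∷ _)) lead = <-≤-trans
  (*-mono-< 0<x (evalDigits-pos 0<x cs lead))
  (m≤n+m (x * evalDigits x cs) c)

evalDigits-∷-monoˡ-< : ∀ {x y} → x < y → ∀ c cs → 0 < evalDigits y cs →
                     evalDigits x (c ∷ cs) < evalDigits y (c ∷ cs)
evalDigits-∷-monoˡ-< {x} {y} x<y c cs 0<Ey = +-monoʳ-< c (begin-strict
  x * evalDigits x cs ≤⟨ *-monoʳ-≤ x (evalDigits-monoˡ-≤ (<⇒≤ x<y) cs) ⟩
  x * evalDigits y cs <⟨ *-monoˡ-< (evalDigits y cs) {{>-nonZero 0<Ey}} x<y ⟩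
  y * evalDigits y cs ∎)
  where open ≤-Reasoning

-- A number at least the base has at least two digits, and then lowering the
-- base strictly lowers the value.
evalDigits-monoˡ-< : ∀ {x y} → x < y → ∀ ds → All (_< y) ds → LeadingNonZero ds →
                     y ≤ evalDigits y ds → evalDigits x ds < evalDigits y ds
evalDigits-monoˡ-< x<y [] _ (_ , () , _) _
evalDigits-monoˡ-< {y = y} x<y (c ∷ []) (c<y ∷ _) _ y≤c+y*0 =
  contradiction (subst (y ≤_) (trans (cong (λ n → c + n) (*-zeroʳ y)) (+-identityʳ c)) y≤c+y*0) (<⇒≱ c<y)
evalDigits-monoˡ-< x<y (c ∷ cs@(_ ∷ _)) _ lead _ =
  evalDigits-∷-monoˡ-< x<y c cs (evalDigits-pos (≤-<-trans z≤n x<y) cs lead)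

theorem2p1 : (a b ℓ : ℕ) → .{{_ : NonZero a}} → .{{_ : NonZero ℓ}} →
    2 ≤ a → 1 ≤ b → Prime ℓ → a ⊔ b < ℓ →
    (ds : List ℕ) → All (λ c → c < a) ds →
    (∃ λ d → last ds ≡ just d × d ≢ 0) →
    evalDigits a ds ≡ ℓ →
    (𝒫 a b ℓ ds a ≡ (+ b) / 1) ×
    ((t : ℕ) → 0 < t → t < a → ¬ (Σ ℤ λ z → 𝒫 a b ℓ ds t ≡ z / 1))
theorem2p1 a b ℓ _ 0<b ℓ-prime a⊔b<ℓ ds digits<a lead Ea≡ℓ = 𝒫[a]≡b , 𝒫[t]∉ℤ
  where
  instance
    ℓ*a≢0 : NonZero (ℓ * a)
    ℓ*a≢0 = m*n≢0 ℓ a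

  a<ℓ : a < ℓ
  a<ℓ = ≤-<-trans (m≤m⊔n a b) a⊔b<ℓ

  b<ℓ : b < ℓ
  b<ℓ = ≤-<-trans (m≤n⊔m a b) a⊔b<ℓ

  numerator[a] : a * b * evalDigits a ds ≡ b * (ℓ * a)
  numerator[a] = begin
    a * b * evalDigits a ds ≡⟨ cong (a * b *_) Ea≡ℓ ⟩
    a * b * ℓ               ≡⟨ cong (_* ℓ) (*-comm a b) ⟩
    b * a * ℓ               ≡⟨ *-assoc b a ℓ ⟩
    b * (a * ℓ)             ≡⟨ cong (b *_) (*-comm a ℓ) ⟩
    b * (ℓ * a)             ∎
    where open ≡-Reasoning

  𝒫[a]≡b : 𝒫 a b ℓ ds a ≡ (+ b) / 1
  𝒫[a]≡b = trans (/-cong (cong +_ numerator[a]) refl) (+[n*d]/d≡+n/1 b (ℓ * a))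

  module _ {t : ℕ} (0<t : 0 < t) (t<a : t < a) where
    Et<ℓ : evalDigits t ds < ℓ
    Et<ℓ = subst (evalDigits t ds <_) Ea≡ℓ
      (evalDigits-monoˡ-< t<a ds digits<a lead (subst (a ≤_) (sym Ea≡ℓ) (<⇒≤ a<ℓ)))

    ℓ∤numerator[t] : ℓ ∤ t * b * evalDigits t ds
    ℓ∤numerator[t] = prime∤-* ℓ-prime
      (prime∤-* ℓ-prime (>⇒∤ {{>-nonZero 0<t}} (<-trans t<a a<ℓ)) (>⇒∤ {{>-nonZero 0<b}} b<ℓ))
      (>⇒∤ {{>-nonZero (evalDigits-pos 0<t ds lead)}} Et<ℓ)

  𝒫[t]∉ℤ : (t : ℕ) → 0 < t → t < a → ¬ (Σ ℤ λ z → 𝒫 a b ℓ ds t ≡ z / 1)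
  𝒫[t]∉ℤ t 0<t t<a (z , 𝒫[t]≡z) =
    ℓ∤numerator[t] 0<t t<a (∣-trans (m∣m*n a) (+m/d≡z/1⇒d∣m _ (ℓ * a) z 𝒫[t]≡z))
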